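{- Let $\mathfrak{A}$ be a $\mathsf{J}^\ast$-model. Then the scheme $\langle n\rangle\varphi\to\varphi$ is valid in $\mathfrak{A}$ (i.e., true at every world) for all $n\ge0$ and all many-sorted formulas $\varphi$ with $|\varphi|\le n$ if and only if $\mathfrak{A}$ is strongly persistent.
   Context: Many-sorted polymodal formulas are built from propositional variables and $\top,\bot$ using $\neg,\land,\lor$ and unary modalities $\langle n\rangle$ for each $n<\omega$ (other Boolean connectives being abbreviations; $[n]\varphi:=\neg\langle n\rangle\neg\varphi$). Each propositional variable $p$ is assigned a unique sort $|p|\in\{0,1,2,\dots\}\cup\{\omega\}$. The sort $|\varphi|$ of a formula is defined by: $\top,\bot$ have sort $0$; $\varphi\land\psi$ and $\varphi\lor\psi$ have sort $\max\{|\varphi|,|\psi|\}$; $\neg\varphi$ has sort $|\varphi|+1$; $\langle n\rangle\varphi$ has sort $n$. A Kripke frame $\langle W,\{R_n\}_{n\ge0}\rangle$ is a $\mathsf{J}^\ast$-frame if: each $R_k$ is transitive and conversely well-founded (no infinite chain $x_0R_kx_1R_kx_2\cdots$); for $m<n$, $xR_ny$ implies ($xR_mz\iff yR_mz$ for all $z$); and for $m<n$, $xR_my$ and $yR_nz$ imply $xR_mz$. A $\mathsf{J}^\ast$-model is a $\mathsf{J}^\ast$-frame with a valuation $\|\cdot\|$ assigning to each variable a subset of $W$, extended to all formulas in the standard way ($x\Vdash\langle n\rangle\psi$ iff there is $y$ with $xR_ny$ and $y\Vdash\psi$). Such a model is strongly persistent if for every propositional variable $p$ and every $n$: if $|p|\le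 n$, $xR_ny$ and $y\Vdash p$, then $x\Vdash p$; and if $|p|<n$, $xR_ny$ and $y\nVdash p$, then $x\nVdash p$. -}

module Defs where

open import Data.Nat using (ℕ; zero; suc; _≤_; _<_; _⊔_)
open import Data.Product using (Σ; _×_; _,_; ∃-syntax)
open import Data.Sum using (_⊎_)
open import Data.Unit using (⊤)
open import Data.Empty using (⊥)
open import Relation.Nullary using (¬_)

data Sort : Set where
  fin : ℕ → Sort
  ω   : Sort

sucˢ : Sort → Sort
sucˢ (fin k) = fin (suc k)
sucˢ ω       = ω

maxˢ : Sort → Sort → Sort
maxˢ (fin k) (fin l) = fin (k ⊔ l)
maxˢ (fin k) ω       = ω
maxˢ ω       _       = ω

_≤ˢ_ : Sort → ℕ → Set
fin k ≤ˢ n = k ≤ n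
ω     ≤ˢ n = ⊥

_<ˢ_ : Sort → ℕ → Set
fin k <ˢ n = k < n
ω     <ˢ n = ⊥

data Fm (Var : Set) : Set where
  var  : Var → Fm Var
  ⊤'   : Fm Var
  ⊥'   : Fm Var
  ¬'_  : Fm Var → Fm Var
  _∧'_ : Fm Var → Fm Var → Fm Var
  _∨'_ : Fm Var → Fm Var → Fm Var
  ⟨_⟩_ : ℕ → Fm Var → Fm Var

sortF : {Var : Set} → (Var → Sort) → Fm Var → Sort
sortF s (var p)   = s p
sortF s ⊤'        = fin 0
sortF s ⊥'        = fin 0
sortF s (¬' φ)    = sucˢ (sortF s φ)
sortF s (φ ∧' ψ)  = maxˢ (sortF s φ) (sortF s ψ)
sortF s (φ ∨' ψ)  = maxˢ (sortF s φ) (sortF s ψ)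
sortF s (⟨ n ⟩ φ) = fin n

record JFrame : Set₁ where
  field
    W : Set
    R : ℕ → W → W → Set
    trans : ∀ k {x y z} → R k x y → R k y z → R k x z
    cwf   : ∀ k → ¬ (Σ (ℕ → W) λ f → ∀ i → R k (f i) (f (suc i)))
    eqv   : ∀ {m n x y} → m < n → R n x y → ∀ z → (R m x z → R m y z) × (R m y z → R m x z)
    mix   : ∀ {m n x y z} → m < n → R m x y → R n y z → R m x z

record JModel (Var : Set) (sort : Var → Sort) : Set₁ where
  field
    frame : JFrame
  open JFrame frame public
  field
    val : Var → W → Set

module _ {Var : Set} {sort : Var → Sort} (𝔄 : JModel Var sort) where
  open JModel 𝔄

  _⊩_ : W → Fm Var → Set
  x ⊩ var p     = val p x
  x ⊩ ⊤'        = ⊤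
  x ⊩ ⊥'        = ⊥
  x ⊩ (¬' φ)    = ¬ (x ⊩ φ)
  x ⊩ (φ ∧' ψ)  = (x ⊩ φ) × (x ⊩ ψ)
  x ⊩ (φ ∨' ψ)  = (x ⊩ φ) ⊎ (x ⊩ ψ)
  x ⊩ (⟨ n ⟩ φ) = ∃[ y ] (R n x y × (y ⊩ φ))

  ReflectionValid : Set
  ReflectionValid = ∀ (n : ℕ) (φ : Fm Var) → sortF sort φ ≤ˢ n →
                    ∀ (x : W) → x ⊩ (⟨ n ⟩ φ) → x ⊩ φ

  StronglyPersistent : Set
  StronglyPersistent =
    (∀ (p : Var) (n : ℕ) → sort p ≤ˢ n → ∀ {x y} → R n x y → val p y → val p x) ×
    (∀ (p : Var) (n : ℕ) → sort p <ˢ n → ∀ {x y} → R n x y → ¬ val p y → ¬ val p x)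

-- Truth of a formula of sort ≤ n and falsity of a formula of sort < n both
-- transfer backwards along R_n, by simultaneous induction on the formula:
-- negation swaps the two statements at the cost of one sort, and a modal
-- formula ⟨m⟩φ of sort m ≤ n is handled by the frame conditions
-- (transitivity when m = n, the condition for m < n otherwise).  Conversely,
-- strong persistence is the instance of the reflection scheme for p and ¬p.
module Submission where

open import Defs
open import Function.Bundles using (_⇔_; mk⇔; module Equivalence)
open import Data.Nat using (_≤_; s≤s)
open import Data.Nat.Properties using (m⊔n≤o⇒m≤o; m⊔n≤o⇒n≤o; m≤n⇒m<n∨m≡n; <⇒≤)
open import Data.Product using (_×_; _,_; proj₁; proj₂)
open import Data.Sum using (inj₁; inj₂)
open import Data.Unit using (tt)
open import Relation.Nullary using (¬_)
open import Relation.Binary.PropositionalEquality using (refl)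

maxˢ-≤ˢ-inv : ∀ a b {n} → maxˢ a b ≤ˢ n → a ≤ˢ n × b ≤ˢ n
maxˢ-≤ˢ-inv (fin k) (fin l) h = m⊔n≤o⇒m≤o k l h , m⊔n≤o⇒n≤o k l h

maxˢ-<ˢ-inv : ∀ a b {n} → maxˢ a b <ˢ n → a <ˢ n × b <ˢ n
maxˢ-<ˢ-inv (fin k) (fin l) (s≤s h) = s≤s (m⊔n≤o⇒m≤o k l h) , s≤s (m⊔n≤o⇒n≤o k l h)

sucˢ-≤ˢ⇔<ˢ : ∀ a {n} → sucˢ a ≤ˢ n ⇔ a <ˢ n
sucˢ-≤ˢ⇔<ˢ (fin k) = mk⇔ (λ h → h) (λ h → h)
sucˢ-≤ˢ⇔<ˢ ω       = mk⇔ (λ ()) (λ ())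

sucˢ-<ˢ⇒≤ˢ : ∀ a {n} → sucˢ a <ˢ n → a ≤ˢ n
sucˢ-<ˢ⇒≤ˢ (fin k) h = <⇒≤ (<⇒≤ h)

module _ (𝔉 : JFrame) where
  open JFrame 𝔉

  R-trans-≤ : ∀ {m n x y z} → m ≤ n → R n x y → R m y z → R m x z
  R-trans-≤ {m} m≤n xRy yRz with m≤n⇒m<n∨m≡n m≤n
  ... | inj₁ m<n  = proj₂ (eqv m<n xRy _) yRz
  ... | inj₂ refl = trans m xRy yRz

module _ {Var : Set} {sort : Var → Sort} (𝔄 : JModel Var sort)
         (persistent : StronglyPersistent 𝔄) where
  open JModel 𝔄

  _⊨_ : W → Fm Var → Set
  x ⊨ φ = _⊩_ 𝔄 x φ

  mutual
    truth-persists : ∀ φ n → sortF sort φ ≤ˢ n → ∀ {x y} → R n x y → y ⊨ φ → x ⊨ φ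
    truth-persists (var p)   n h r y⊨p = proj₁ persistent p n h r y⊨p
    truth-persists ⊤'        n h r _   = tt
    truth-persists (¬' φ)    n h r y⊭φ =
      falsity-persists φ n (Equivalence.to (sucˢ-≤ˢ⇔<ˢ (sortF sort φ)) h) r y⊭φ
    truth-persists (φ ∧' ψ)  n h r (y⊨φ , y⊨ψ) =
      let hφ , hψ = maxˢ-≤ˢ-inv (sortF sort φ) (sortF sort ψ) h
      in truth-persists φ n hφ r y⊨φ , truth-persists ψ n hψ r y⊨ψ
    truth-persists (φ ∨' ψ)  n h r (inj₁ y⊨φ) =
      inj₁ (truth-persists φ n (proj₁ (maxˢ-≤ˢ-inv (sortF sort φ) (sortF sort ψ) h)) r y⊨φ)
    truth-persists (φ ∨' ψ)  n h r (inj₂ y⊨ψ) =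
      inj₂ (truth-persists ψ n (proj₂ (maxˢ-≤ˢ-inv (sortF sort φ) (sortF sort ψ) h)) r y⊨ψ)
    truth-persists (⟨ m ⟩ φ) n h r (z , yRz , z⊨φ) = z , R-trans-≤ frame h r yRz , z⊨φ

    falsity-persists : ∀ φ n → sortF sort φ <ˢ n → ∀ {x y} → R n x y → ¬ y ⊨ φ → ¬ x ⊨ φ
    falsity-persists (var p)   n h r y⊭p = proj₂ persistent p n h r y⊭p
    falsity-persists ⊤'        n h r y⊭⊤ _ = y⊭⊤ tt
    falsity-persists (¬' φ)    n h r y⊭¬φ x⊭φ =
      y⊭¬φ (λ y⊨φ → x⊭φ (truth-persists φ n (sucˢ-<ˢ⇒≤ˢ (sortF sort φ) h) r y⊨φ))
    falsity-persists (φ ∧' ψ)  n h r y⊭φ∧ψ (x⊨φ , x⊨ψ) =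
      let hφ , hψ = maxˢ-<ˢ-inv (sortF sort φ) (sortF sort ψ) h
      in falsity-persists φ n hφ r (λ y⊨φ →
           falsity-persists ψ n hψ r (λ y⊨ψ → y⊭φ∧ψ (y⊨φ , y⊨ψ)) x⊨ψ) x⊨φ
    falsity-persists (φ ∨' ψ)  n h r y⊭φ∨ψ (inj₁ x⊨φ) =
      falsity-persists φ n (proj₁ (maxˢ-<ˢ-inv (sortF sort φ) (sortF sort ψ) h)) r
        (λ y⊨φ → y⊭φ∨ψ (inj₁ y⊨φ)) x⊨φ
    falsity-persists (φ ∨' ψ)  n h r y⊭φ∨ψ (inj₂ x⊨ψ) =
      falsity-persists ψ n (proj₂ (maxˢ-<ˢ-inv (sortF sort φ) (sortF sort ψ) h)) r
        (λ y⊨ψ → y⊭φ∨ψ (inj₂ y⊨ψ)) x⊨ψ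
    falsity-persists (⟨ m ⟩ φ) n h r y⊭⟨m⟩φ (z , xRz , z⊨φ) =
      y⊭⟨m⟩φ (z , proj₁ (eqv h r z) xRz , z⊨φ)

mainTheorem2 : {Var : Set} {sort : Var → Sort} (𝔄 : JModel Var sort) →
    ReflectionValid 𝔄 ⇔ StronglyPersistent 𝔄
mainTheorem2 {sort = sort} 𝔄 = mk⇔ persistence reflection
  where
  persistence : ReflectionValid 𝔄 → StronglyPersistent 𝔄
  persistence valid =
      (λ p n h {x} {y} r y⊨p → valid n (var p) h x (y , r , y⊨p))
    , (λ p n h {x} {y} r y⊭p → valid n (¬' var p) (Equivalence.from (sucˢ-≤ˢ⇔<ˢ (sort p)) h) x (y , r , y⊭p))

  reflection : StronglyPersistent 𝔄 → ReflectionValid 𝔄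
  reflection persistent n φ h x (y , r , y⊨φ) = truth-persists 𝔄 persistent φ n h r y⊨φ
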